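{- Let $F=\prod_i \alpha_i.F_i$ be a finite process, $F'$ a finite process, $\alpha$ an action and $Q$ a process. If $!F\sim\ !\alpha.F'|Q$, then there exists $j$ such that $\alpha_j=\alpha$ and $!F\sim\ !\alpha.F'\,|\,\prod_{i\neq j}!\alpha_i.F_i$.
   Context: Fix a countable set of actions. Finite processes: $F ::= 0 \mid \alpha.F \mid F|F$. Processes: $P ::= F \mid\ !\alpha.F \mid P|P$. $\prod_i$ denotes parallel composition; for $F=\prod_i\alpha_i.F_i$, $!F$ denotes $\prod_i!\alpha_i.F_i$. Transitions: $\alpha.F\xrightarrow{\alpha}F$; $!\alpha.F\xrightarrow{\alpha}\ !\alpha.F|F$; if $P_1\xrightarrow{\alpha}P_1'$ then $P_1|P_2\xrightarrow{\alpha}P_1'|P_2$ and $P_2|P_1\xrightarrow{\alpha}P_2|P_1'$. $\sim$ is strong bisimilarity for this transition system. -}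

module Defs where

open import Data.Nat using (ℕ)
open import Data.List using (List; []; _∷_; length; lookup; removeAt)
open import Data.Fin using (Fin)
open import Data.Product using (Σ; ∃; _×_; _,_; proj₁; proj₂)
open import Function.Definitions using (Injective)
open import Relation.Binary.PropositionalEquality using (_≡_)

Countable : Set → Set
Countable A = Σ (A → ℕ) λ enc → Injective _≡_ _≡_ enc

data FProc (A : Set) : Set where
  𝟘    : FProc A
  _∙_  : A → FProc A → FProc A
  _∣_  : FProc A → FProc A → FProc A

-- Processes  P ::= F | !α.F | P|P
-- (a finite process is embedded via `emb`; the constructors below are
--  exactly 0, α.F (F finite), !α.F (F finite) and P|P)
data Proc (A : Set) : Set where
  nil  : Proc A
  pre  : A → FProc A → Proc A
  bang : A → FProc A → Proc A
  par  : Proc A → Proc A → Proc A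

emb : {A : Set} → FProc A → Proc A
emb 𝟘       = nil
emb (α ∙ F) = pre α F
emb (F ∣ G) = par (emb F) (emb G)

data _—[_]→_ {A : Set} : Proc A → A → Proc A → Set where
  t-pre  : ∀ {α F} → pre α F —[ α ]→ emb F
  t-bang : ∀ {α F} → bang α F —[ α ]→ par (bang α F) (emb F)
  t-parL : ∀ {P P′ Q α} → P —[ α ]→ P′ → par P Q —[ α ]→ par P′ Q
  t-parR : ∀ {P Q Q′ α} → Q —[ α ]→ Q′ → par P Q —[ α ]→ par P Q′

IsBisimulation : {A : Set} → (Proc A → Proc A → Set) → Set
IsBisimulation {A} R =
  ∀ P Q → R P Q →
    (∀ α P′ → P —[ α ]→ P′ → ∃ λ Q′ → (Q —[ α ]→ Q′) × R P′ Q′)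
  × (∀ α Q′ → Q —[ α ]→ Q′ → ∃ λ P′ → (P —[ α ]→ P′) × R P′ Q′)

_∼_ : {A : Set} → Proc A → Proc A → Set₁
_∼_ {A} P Q = Σ (Proc A → Proc A → Set) λ R → IsBisimulation R × R P Q

∏fin : {A : Set} → List (A × FProc A) → FProc A
∏fin []             = 𝟘
∏fin ((α , F) ∷ xs) = (α ∙ F) ∣ ∏fin xs

∏bang : {A : Set} → List (A × FProc A) → Proc A
∏bang []             = nil
∏bang ((α , F) ∷ xs) = par (bang α F) (∏bang xs)

-- For F = ∏_i α_i.F_i (given by its component list), !F = ∏_i !α_i.F_i
!_ : {A : Set} → List (A × FProc A) → Proc A
! xs = ∏bang xs

-- The α-move of !α.F′ in  !α.F′ | Q  must be answered by some summand !α_j.F_j of !F, which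
-- shows  !F | F_j ≈ !F | F′  up to structural congruence.  That equation is exactly what makes
-- the relation  (!α.F_j | R) | X  ↦  (!α.F′ | R) | X, with R the remaining summands, a
-- bisimulation up to structural congruence: a firing of the replaced replica leaves an extra
-- F_j on one side and an extra F′ on the other, and the equation trades one for the other.
module Submission where

open import Defs
open import Level using (0ℓ)
open import Data.List using (List; _∷_; length; lookup; removeAt)
open import Data.Fin using (Fin; zero; suc)
open import Data.Product using (∃; _×_; _,_; proj₁; proj₂; map₂)
open import Function using (_∘_)
open import Data.Sum using (inj₁; inj₂)
open import Relation.Binary using (Rel; Setoid; IsEquivalence)
open import Relation.Binary.Construct.Union using (_∪_)
open import Relation.Binary.PropositionalEquality using (_≡_; refl)
import Relation.Binary.Reasoning.Setoid as SetoidReasoning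

data Closure {A : Set} (R : Rel (Proc A) 0ℓ) : Rel (Proc A) 0ℓ where
  base          : ∀ {P Q} → R P Q → Closure R P Q
  ≈-refl        : ∀ {P} → Closure R P P
  ≈-sym         : ∀ {P Q} → Closure R P Q → Closure R Q P
  ≈-trans       : ∀ {P Q S} → Closure R P Q → Closure R Q S → Closure R P S
  par-cong      : ∀ {P Q X Y} → Closure R P Q → Closure R X Y → Closure R (par P X) (par Q Y)
  par-comm      : ∀ {P Q} → Closure R (par P Q) (par Q P)
  par-assoc     : ∀ {P Q S} → Closure R (par (par P Q) S) (par P (par Q S))
  par-identityʳ : ∀ {P} → Closure R (par P nil) P

Progresses : {A : Set} → Rel (Proc A) 0ℓ → Rel (Proc A) 0ℓ → Set
Progresses R S =
  ∀ P Q → R P Q →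
    (∀ α P′ → P —[ α ]→ P′ → ∃ λ Q′ → (Q —[ α ]→ Q′) × S P′ Q′)
  × (∀ α Q′ → Q —[ α ]→ Q′ → ∃ λ P′ → (P —[ α ]→ P′) × S P′ Q′)

module _ {A : Set} {R : Rel (Proc A) 0ℓ} where

  Closure-isEquivalence : IsEquivalence (Closure R)
  Closure-isEquivalence = record { refl = ≈-refl ; sym = ≈-sym ; trans = ≈-trans }

  Closure-setoid : Setoid 0ℓ 0ℓ
  Closure-setoid = record { isEquivalence = Closure-isEquivalence }

  Closure-mono : ∀ {S} → (∀ {P Q} → R P Q → S P Q) → ∀ {P Q} → Closure R P Q → Closure S P Q
  Closure-mono f (base r)          = base (f r)
  Closure-mono f ≈-refl            = ≈-refl
  Closure-mono f (≈-sym p)         = ≈-sym (Closure-mono f p)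
  Closure-mono f (≈-trans p q)     = ≈-trans (Closure-mono f p) (Closure-mono f q)
  Closure-mono f (par-cong p q)    = par-cong (Closure-mono f p) (Closure-mono f q)
  Closure-mono f par-comm          = par-comm
  Closure-mono f par-assoc         = par-assoc
  Closure-mono f par-identityʳ     = par-identityʳ

  par-swapʳ : ∀ {P Q S} → Closure R (par (par P Q) S) (par (par P S) Q)
  par-swapʳ = ≈-trans par-assoc (≈-trans (par-cong ≈-refl par-comm) (≈-sym par-assoc))

  par-swapˡ : ∀ {P Q S} → Closure R (par P (par Q S)) (par Q (par P S))
  par-swapˡ = ≈-trans (≈-sym par-assoc) (≈-trans (par-cong par-comm ≈-refl) par-assoc)

  closure-progressˡ : Progresses R (Closure R) → ∀ {P Q α P′} → Closure R P Q →
    P —[ α ]→ P′ → ∃ λ Q′ → (Q —[ α ]→ Q′) × Closure R P′ Q′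
  closure-progressʳ : Progresses R (Closure R) → ∀ {P Q α Q′} → Closure R P Q →
    Q —[ α ]→ Q′ → ∃ λ P′ → (P —[ α ]→ P′) × Closure R P′ Q′

  closure-progressˡ prog (base r) t = proj₁ (prog _ _ r) _ _ t
  closure-progressˡ prog ≈-refl t = _ , t , ≈-refl
  closure-progressˡ prog (≈-sym p) t with closure-progressʳ prog p t
  ... | Q′ , t′ , e = Q′ , t′ , ≈-sym e
  closure-progressˡ prog (≈-trans p q) t with closure-progressˡ prog p t
  ... | _ , t₁ , e₁ with closure-progressˡ prog q t₁
  ... | _ , t₂ , e₂ = _ , t₂ , ≈-trans e₁ e₂
  closure-progressˡ prog (par-cong p q) (t-parL t) with closure-progressˡ prog p t
  ... | _ , t′ , e = _ , t-parL t′ , par-cong e q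
  closure-progressˡ prog (par-cong p q) (t-parR t) with closure-progressˡ prog q t
  ... | _ , t′ , e = _ , t-parR t′ , par-cong p e
  closure-progressˡ prog par-comm (t-parL t) = _ , t-parR t , par-comm
  closure-progressˡ prog par-comm (t-parR t) = _ , t-parL t , par-comm
  closure-progressˡ prog par-assoc (t-parL (t-parL t)) = _ , t-parL t , par-assoc
  closure-progressˡ prog par-assoc (t-parL (t-parR t)) = _ , t-parR (t-parL t) , par-assoc
  closure-progressˡ prog par-assoc (t-parR t) = _ , t-parR (t-parR t) , par-assoc
  closure-progressˡ prog par-identityʳ (t-parL t) = _ , t , par-identityʳ
  closure-progressˡ prog par-identityʳ (t-parR ())

  closure-progressʳ prog (base r) t = proj₂ (prog _ _ r) _ _ t
  closure-progressʳ prog ≈-refl t = _ , t , ≈-refl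
  closure-progressʳ prog (≈-sym p) t with closure-progressˡ prog p t
  ... | P′ , t′ , e = P′ , t′ , ≈-sym e
  closure-progressʳ prog (≈-trans p q) t with closure-progressʳ prog q t
  ... | _ , t₂ , e₂ with closure-progressʳ prog p t₂
  ... | _ , t₁ , e₁ = _ , t₁ , ≈-trans e₁ e₂
  closure-progressʳ prog (par-cong p q) (t-parL t) with closure-progressʳ prog p t
  ... | _ , t′ , e = _ , t-parL t′ , par-cong e q
  closure-progressʳ prog (par-cong p q) (t-parR t) with closure-progressʳ prog q t
  ... | _ , t′ , e = _ , t-parR t′ , par-cong p e
  closure-progressʳ prog par-comm (t-parL t) = _ , t-parR t , par-comm
  closure-progressʳ prog par-comm (t-parR t) = _ , t-parL t , par-comm
  closure-progressʳ prog par-assoc (t-parL t) = _ , t-parL (t-parL t) , par-assoc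
  closure-progressʳ prog par-assoc (t-parR (t-parL t)) = _ , t-parL (t-parR t) , par-assoc
  closure-progressʳ prog par-assoc (t-parR (t-parR t)) = _ , t-parR t , par-assoc
  closure-progressʳ prog par-identityʳ t = _ , t-parL t , par-identityʳ

  closure-isBisimulation : Progresses R (Closure R) → IsBisimulation (Closure R)
  closure-isBisimulation prog _ _ p =
    (λ _ _ → closure-progressˡ prog p) , (λ _ _ → closure-progressʳ prog p)

  bisimilar-upto-closure : Progresses R (Closure R) → ∀ {P Q} → Closure R P Q → P ∼ Q
  bisimilar-upto-closure prog p = Closure R , closure-isBisimulation prog , p

  ∏bang-step : ∀ rs {β R′} → ∏bang rs —[ β ]→ R′ →
    ∃ λ (j : Fin (length rs)) →
      (proj₁ (lookup rs j) ≡ β) × Closure R R′ (par (∏bang rs) (emb (proj₂ (lookup rs j))))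
  ∏bang-step ((a , G) ∷ rs) (t-parL t-bang) = zero , refl , par-swapʳ
  ∏bang-step ((a , G) ∷ rs) (t-parR t) with ∏bang-step rs t
  ... | j , eq , e = suc j , eq , ≈-trans (par-cong ≈-refl e) (≈-sym par-assoc)

  ∏bang-removeAt : ∀ rs (j : Fin (length rs)) →
    Closure R (∏bang rs)
      (par (bang (proj₁ (lookup rs j)) (proj₂ (lookup rs j))) (∏bang (removeAt rs j)))
  ∏bang-removeAt ((a , G) ∷ rs) zero    = ≈-refl
  ∏bang-removeAt ((a , G) ∷ rs) (suc j) = ≈-trans (par-cong ≈-refl (∏bang-removeAt rs j)) par-swapˡ

matching-summand : ∀ {A : Set} {R₀ : Rel (Proc A) 0ℓ} → IsBisimulation R₀ →
  ∀ Fs {F′ α Q} → R₀ (∏bang Fs) (par (bang α F′) Q) →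
  ∃ λ (j : Fin (length Fs)) → (proj₁ (lookup Fs j) ≡ α)
    × Closure R₀ (par (∏bang Fs) (emb (proj₂ (lookup Fs j)))) (par (∏bang Fs) (emb F′))
matching-summand {R₀ = R₀} isb Fs {F′} {α} {Q} h with proj₂ (isb _ _ h) α _ (t-parL t-bang)
... | P′ , t , h′ with ∏bang-step Fs t
... | j , eq , e = j , eq , (begin
    par (∏bang Fs) (emb (proj₂ (lookup Fs j))) ≈⟨ e ⟨
    P′                                          ≈⟨ base h′ ⟩
    par (par (bang α F′) (emb F′)) Q            ≈⟨ par-swapʳ ⟩
    par (par (bang α F′) Q) (emb F′)            ≈⟨ par-cong (base h) ≈-refl ⟨
    par (∏bang Fs) (emb F′)                     ∎)
  where open SetoidReasoning (Closure-setoid {R = R₀})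

module Replacement {A : Set} {R₀ : Rel (Proc A) 0ℓ} (isb : IsBisimulation R₀)
  (α : A) (G F′ : FProc A) (rs : List (A × FProc A)) {S : Proc A}
  (S≈ : Closure R₀ S (par (bang α G) (∏bang rs)))
  (S-absorbs : Closure R₀ (par S (emb G)) (par S (emb F′))) where

  AR BR : Proc A
  AR = par (bang α G) (∏bang rs)
  BR = par (bang α F′) (∏bang rs)

  data Replaced : Rel (Proc A) 0ℓ where
    replaced : ∀ X → Replaced (par AR X) (par BR X)

  _≈_ : Rel (Proc A) 0ℓ
  _≈_ = Closure (R₀ ∪ Replaced)

  lift : ∀ {P Q} → Closure R₀ P Q → P ≈ Q
  lift = Closure-mono inj₁

  regroup : ∀ {P R H X} → Closure R₀ R (par (∏bang rs) H) →
    par (par P R) X ≈ par (par P (∏bang rs)) (par H X)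
  regroup e = ≈-trans (par-cong (par-cong ≈-refl (lift e)) ≈-refl)
    (≈-trans (par-cong (≈-sym par-assoc) ≈-refl) par-assoc)

  AR-absorbs : Closure R₀ (par AR (emb G)) (par AR (emb F′))
  AR-absorbs = ≈-trans (par-cong (≈-sym S≈) ≈-refl) (≈-trans S-absorbs (par-cong S≈ ≈-refl))

  after-bang : ∀ X → par (par (par (bang α G) (emb G)) (∏bang rs)) X
                   ≈ par (par (par (bang α F′) (emb F′)) (∏bang rs)) X
  after-bang X = begin
    par (par (par (bang α G) (emb G)) (∏bang rs)) X   ≈⟨ par-cong par-swapʳ ≈-refl ⟩
    par (par AR (emb G)) X                           ≈⟨ par-cong (lift AR-absorbs) ≈-refl ⟩
    par (par AR (emb F′)) X                          ≈⟨ par-assoc ⟩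
    par AR (par (emb F′) X)                          ≈⟨ base (inj₂ (replaced _)) ⟩
    par BR (par (emb F′) X)                          ≈⟨ par-assoc ⟨
    par (par BR (emb F′)) X                          ≈⟨ par-cong par-swapʳ ≈-refl ⟩
    par (par (par (bang α F′) (emb F′)) (∏bang rs)) X ∎
    where open SetoidReasoning (Closure-setoid {R = R₀ ∪ Replaced})

  after-summand : ∀ X {β R′} → ∏bang rs —[ β ]→ R′ →
    par (par (bang α G) R′) X ≈ par (par (bang α F′) R′) X
  after-summand X t with ∏bang-step rs t
  ... | _ , _ , e = ≈-trans (regroup e) (≈-trans (base (inj₂ (replaced _))) (≈-sym (regroup e)))

  replaced-progressˡ : ∀ {P Q β P′} → Replaced P Q → P —[ β ]→ P′ →
    ∃ λ Q′ → (Q —[ β ]→ Q′) × P′ ≈ Q′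
  replaced-progressˡ (replaced X) (t-parL (t-parL t-bang)) = _ , t-parL (t-parL t-bang) , after-bang X
  replaced-progressˡ (replaced X) (t-parL (t-parR t)) = _ , t-parL (t-parR t) , after-summand X t
  replaced-progressˡ (replaced X) (t-parR t) = _ , t-parR t , base (inj₂ (replaced _))

  replaced-progressʳ : ∀ {P Q β Q′} → Replaced P Q → Q —[ β ]→ Q′ →
    ∃ λ P′ → (P —[ β ]→ P′) × P′ ≈ Q′
  replaced-progressʳ (replaced X) (t-parL (t-parL t-bang)) = _ , t-parL (t-parL t-bang) , after-bang X
  replaced-progressʳ (replaced X) (t-parL (t-parR t)) = _ , t-parL (t-parR t) , after-summand X t
  replaced-progressʳ (replaced X) (t-parR t) = _ , t-parR t , base (inj₂ (replaced _))

  progresses : Progresses (R₀ ∪ Replaced) _≈_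
  progresses P Q (inj₁ r) =
    (λ β P′ t → map₂ (map₂ (base ∘ inj₁)) (proj₁ (isb P Q r) β P′ t)) ,
    (λ β Q′ t → map₂ (map₂ (base ∘ inj₁)) (proj₂ (isb P Q r) β Q′ t))
  progresses P Q (inj₂ r) = (λ _ _ → replaced-progressˡ r) , (λ _ _ → replaced-progressʳ r)

  S∼BR : S ∼ BR
  S∼BR = bisimilar-upto-closure progresses (begin
    S          ≈⟨ lift S≈ ⟩
    AR         ≈⟨ par-identityʳ ⟨
    par AR nil ≈⟨ base (inj₂ (replaced nil)) ⟩
    par BR nil ≈⟨ par-identityʳ ⟩
    BR         ∎)
    where open SetoidReasoning (Closure-setoid {R = R₀ ∪ Replaced})

lemma2 : {A : Set} → Countable A →
    (Fs : List (A × FProc A)) (F′ : FProc A) (α : A) (Q : Proc A) →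
    (! Fs) ∼ par (bang α F′) Q →
    ∃ λ (j : Fin (length Fs)) →
    (proj₁ (lookup Fs j) ≡ α) × ((! Fs) ∼ par (bang α F′) (∏bang (removeAt Fs j)))
lemma2 _ Fs F′ α Q (R₀ , isb , h) with matching-summand isb Fs h
... | j , refl , absorbs =
  j , refl , Replacement.S∼BR isb α (proj₂ (lookup Fs j)) F′ (removeAt Fs j)
               (∏bang-removeAt Fs j) absorbs
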